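{- For every $n\ge 1$, the path $P_n$ is $Q$-unique: if $H$ is a finite simple graph with $Q(H;x,y)=Q(P_n;x,y)$, then $H\cong P_n$.
   Context: For a finite simple graph $G=(V,E)$, the subgraph component polynomial is $Q(G;x,y)=\sum_{X\subseteq V} x^{|X|}y^{k(G[X])}$, where $G[X]$ is the induced subgraph on $X$ and $k(\cdot)$ denotes the number of connected components. $P_n$ is the path on $n$ vertices. -}

module Defs where

open import Data.Bool using (Bool; true; false; _∧_; _∨_; not; if_then_else_)
open import Data.Nat using (ℕ; zero; suc; _≡ᵇ_; _<ᵇ_)
open import Data.Fin using (Fin; toℕ)
open import Data.Fin.Subset using (Subset; ∣_∣)
open import Data.Vec using (Vec; []; _∷_; lookup)
open import Data.List using (List; []; _∷_; map; _++_; allFin)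
open import Data.Bool.ListAction using (any)
open import Data.Nat.ListAction using (sum)
open import Data.Bool.Properties using (∨-comm)
open import Function.Bundles using (_↔_; Inverse)
open import Relation.Binary.PropositionalEquality using (_≡_; refl)

record Graph (m : ℕ) : Set where
  field
    adj    : Fin m → Fin m → Bool
    sym    : ∀ u v → adj u v ≡ adj v u
    irrefl : ∀ v → adj v v ≡ false
open Graph public

-- Vertex subsets X ⊆ V (stdlib Subset m = Vec Bool m; true = inside).
inS : ∀ {m} → Subset m → Fin m → Bool
inS X v = lookup X v

allSubsets : ∀ m → List (Subset m)
allSubsets zero    = [] ∷ []
allSubsets (suc m) = map (false ∷_) (allSubsets m) ++ map (true ∷_) (allSubsets m)

-- walkWithin G X t u v : there is a walk of length ≤ t from u to v
-- all of whose vertices lie in X (i.e. a walk in the induced subgraph G[X]).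
walkWithin : ∀ {m} → Graph m → Subset m → ℕ → Fin m → Fin m → Bool
walkWithin {m} G X zero    u v = inS X u ∧ (toℕ u ≡ᵇ toℕ v)
walkWithin {m} G X (suc t) u v =
  walkWithin G X t u v ∨
  any (λ w → walkWithin G X t u w ∧ (adj G w v ∧ inS X v)) (allFin m)

-- u and v are connected in G[X] (a walk exists iff one of length ≤ m exists).
connectedIn : ∀ {m} → Graph m → Subset m → Fin m → Fin m → Bool
connectedIn {m} G X u v = walkWithin G X m u v

-- Number of connected components k(G[X]): each component is counted once,
-- via its vertex of least index.
countTrue : ∀ {m} → (Fin m → Bool) → ℕ
countTrue {m} p = sum (map (λ v → if p v then 1 else 0) (allFin m))

components : ∀ {m} → Graph m → Subset m → ℕ
components {m} G X =
  countTrue (λ v → inS X v ∧ not (any (λ u → (toℕ u <ᵇ toℕ v) ∧ connectedIn G X u v) (allFin m)))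

-- Coefficient of x^i y^j in Q(G;x,y) = Σ_{X ⊆ V} x^{|X|} y^{k(G[X])}:
-- the number of X ⊆ V with |X| = i and k(G[X]) = j.
Qcoeff : ∀ {m} → Graph m → ℕ → ℕ → ℕ
Qcoeff {m} G i j =
  sum (map (λ X → if (∣ X ∣ ≡ᵇ i) ∧ (components G X ≡ᵇ j) then 1 else 0) (allSubsets m))

_≡Q_ : ∀ {m n} → Graph m → Graph n → Set
G ≡Q H = ∀ i j → Qcoeff G i j ≡ Qcoeff H i j

_≅_ : ∀ {m n} → Graph m → Graph n → Set
_≅_ {m} {n} G H =
  Σ' (Fin m ↔ Fin n) (λ f → ∀ u v → adj G u v ≡ adj H (Inverse.to f u) (Inverse.to f v))
  where
  open import Data.Product using () renaming (Σ to Σ')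

pathAdj : ∀ {n} → Fin n → Fin n → Bool
pathAdj i j = (suc (toℕ i) ≡ᵇ toℕ j) ∨ (suc (toℕ j) ≡ᵇ toℕ i)

private
  suc≢ᵇ : ∀ k → (suc k ≡ᵇ k) ≡ false
  suc≢ᵇ zero    = refl
  suc≢ᵇ (suc k) = suc≢ᵇ k

P : (n : ℕ) → Graph n
P n = record
  { adj    = pathAdj
  ; sym    = λ u v → ∨-comm (suc (toℕ u) ≡ᵇ toℕ v) (suc (toℕ v) ≡ᵇ toℕ u)
  ; irrefl = λ v → irr (toℕ v)
  }
  where
  irr : ∀ k → ((suc k ≡ᵇ k) ∨ (suc k ≡ᵇ k)) ≡ false
  irr k rewrite suc≢ᵇ k = refl

module Submission where

-- Each coefficient of Q counts the vertex sets of a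
-- given size inducing a given number of components, so if Q(H) = Q(P_{k+1})
-- every (size, components) pair realised in one graph is realised in the
-- other.  Transferring facts about P_{k+1} this way: H has k+1 vertices, is
-- connected, has at most k edges (connected 2-sets), each vertex-deleted
-- subgraph has at most 2 components, and some vertex r can be deleted leaving
-- H connected.  Take the breadth-first tree from r (depth, parent).  The k
-- parent edges and any further edge would give k+1 connected 2-sets, so every
-- edge joins a vertex to its parent.  Two children x ≠ y of a vertex v would
-- make the branches below x and y (and, if v ≠ r, the part above v) separate
-- components of H − v, exceeding the bound; so each depth holds one vertex,
-- depth is a bijection onto {0,…,k}, and u ~ v iff their depths differ by 1.
-- Order of the file: Boolean and counting lemmas; walks and components of
-- induced subgraphs; the sets V∖{r} and {a,b}; transfer along Q; facts about
-- P; the breadth-first tree; recognition of paths; the theorem.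

open import Defs renaming (sym to adj-sym; irrefl to adj-irrefl)
open import Data.Bool using (Bool; true; false; _∧_; _∨_; not; if_then_else_)
open import Data.Bool.Properties using (∨-zeroʳ; ∨-comm; T-≡) renaming (_≟_ to _≟ᵇ_)
open import Data.Bool.ListAction using (any)
open import Data.Nat using (ℕ; zero; suc; _+_; _∸_; _≤_; _<_; _≥_; z≤n; s≤s; s≤s⁻¹; _≡ᵇ_; _<ᵇ_)
open import Data.Nat.Properties
  using (≤-refl; ≤-trans; ≤-antisym; ≤-reflexive; <-trans; <-asym; <-irrefl; <-cmp; 1+n≰n;
         ≮⇒≥; <⇒≤; n≤1+n; +-mono-≤; n≤0⇒n≡0; +-comm; suc-injective; m∸n≤m; m∸[m∸n]≡n; +-∸-assoc; n∸n≡0; ≡ᵇ⇒≡; ≡⇒≡ᵇ; <ᵇ⇒<; <⇒<ᵇ)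
open import Data.Nat.ListAction using (sum)
open import Data.Nat.GeneralisedArithmetic using (iterate)
open import Data.Fin using (Fin; zero; suc; toℕ; fromℕ; fromℕ<; inject₁; punchIn; punchOut)
open import Data.Fin.Properties
  using (_≟_; any?; toℕ-injective; toℕ-inject₁; toℕ-fromℕ<; inject₁-injective; fromℕ≢inject₁; <⇒≢;
         punchIn-injective; punchInᵢ≢i; toℕ<n; punchIn-punchOut; punchOut-injective; injective⇒≤)
open import Data.Fin.Subset using (Subset; ∣_∣; ⊤)
open import Data.Fin.Subset.Properties using (∣p∣≤n; ∣⊤∣≡n; ∣p∣≡n⇒p≡⊤)
open import Data.Vec using ([]; _∷_; tabulate)
open import Data.Vec.Properties using (lookup∘tabulate; lookup-replicate; tabulate-cong) renaming (≡-dec to ≡-decVec)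
open import Data.List using (List; []; _∷_; map; allFin)
open import Data.List.Properties using (map-tabulate)
open import Data.List.Membership.Propositional using (_∈_)
open import Data.List.Membership.Propositional.Properties using (∈-allFin; ∈-++⁺ˡ; ∈-++⁺ʳ; ∈-map⁺; ∈-map⁻)
open import Data.List.Relation.Unary.Any using (here; there)
open import Data.List.Relation.Unary.All using ([]) renaming (lookup to lookupAll)
open import Data.List.Relation.Unary.AllPairs using ([]; _∷_)
open import Data.List.Relation.Unary.Unique.Propositional using (Unique)
import Data.List.Relation.Unary.Unique.Propositional.Properties as Unique
open import Data.Maybe using (Maybe; just; nothing)
open import Data.Product using (∃; ∃₂; _×_; _,_; proj₁; proj₂)
open import Data.Sum using (_⊎_; inj₁; inj₂)
open import Data.Empty using (⊥; ⊥-elim)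
open import Function using (_∘_; id)
open import Function.Bundles using (Equivalence; mk↔ₛ′)
open import Function.Definitions using (Injective)
open import Relation.Binary using (DecidableEquality; tri<; tri≈; tri>)
open import Relation.Binary.PropositionalEquality using (_≡_; _≢_; refl; sym; trans; cong; cong₂; subst; module ≡-Reasoning)
open import Relation.Nullary using (¬_; yes; no)
open import Relation.Nullary.Decidable using (¬?; _×-dec_)

false≢true : false ≢ true
false≢true ()

∧-elim : ∀ {a b} → a ∧ b ≡ true → a ≡ true × b ≡ true
∧-elim {true} {true} _ = refl , refl

∨-elim : ∀ {a b} → a ∨ b ≡ true → a ≡ true ⊎ b ≡ true
∨-elim {true} _ = inj₁ refl
∨-elim {false} b = inj₂ b

∨-introˡ : ∀ {a} b → a ≡ true → a ∨ b ≡ true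
∨-introˡ b refl = refl

∨-introʳ : ∀ a {b} → b ≡ true → a ∨ b ≡ true
∨-introʳ a refl = ∨-zeroʳ a

¬true⇒false : ∀ {b} → b ≢ true → b ≡ false
¬true⇒false {true} ¬b = ⊥-elim (¬b refl)
¬true⇒false {false} _ = refl

¬false⇒true : ∀ {b} → b ≢ false → b ≡ true
¬false⇒true {true} _ = refl
¬false⇒true {false} ¬b = ⊥-elim (¬b refl)

∧-not-false : ∀ {a b} → a ≡ true → a ∧ not b ≡ false → b ≡ true
∧-not-false {b = true} _ _ = refl
∧-not-false {true} {false} _ ()

bool-ext : ∀ {a b} → (a ≡ true → b ≡ true) → (b ≡ true → a ≡ true) → a ≡ b
bool-ext {true} a⇒b _ = sym (a⇒b refl)
bool-ext {false} {true} _ b⇒a = b⇒a refl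
bool-ext {false} {false} _ _ = refl

≡ᵇ-sound : ∀ {m n} → (m ≡ᵇ n) ≡ true → m ≡ n
≡ᵇ-sound {m} {n} e = ≡ᵇ⇒≡ m n (Equivalence.from T-≡ e)

≡ᵇ-complete : ∀ {m n} → m ≡ n → (m ≡ᵇ n) ≡ true
≡ᵇ-complete {m} {n} m≡n = Equivalence.to T-≡ (≡⇒≡ᵇ m n m≡n)

<ᵇ-sound : ∀ {m n} → (m <ᵇ n) ≡ true → m < n
<ᵇ-sound {m} {n} e = <ᵇ⇒< m n (Equivalence.from T-≡ e)

<ᵇ-complete : ∀ {m n} → m < n → (m <ᵇ n) ≡ true
<ᵇ-complete m<n = Equivalence.to T-≡ (<⇒<ᵇ m<n)

<ᵇ-false : ∀ {m n} → n ≤ m → (m <ᵇ n) ≡ false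
<ᵇ-false n≤m = ¬true⇒false (λ e → 1+n≰n (≤-trans (<ᵇ-sound e) n≤m))

_==_ : ∀ {n} → Fin n → Fin n → Bool
u == v = toℕ u ≡ᵇ toℕ v

==-sound : ∀ {n} {u v : Fin n} → (u == v) ≡ true → u ≡ v
==-sound e = toℕ-injective (≡ᵇ-sound e)

==-refl : ∀ {n} (u : Fin n) → (u == u) ≡ true
==-refl u = ≡ᵇ-complete {toℕ u} refl

==-false : ∀ {n} {u v : Fin n} → u ≢ v → (u == v) ≡ false
==-false u≢v = ¬true⇒false (u≢v ∘ ==-sound)

any-elim : ∀ {A : Set} (q : A → Bool) xs → any q xs ≡ true → ∃ λ x → q x ≡ true
any-elim q (x ∷ xs) e with ∨-elim {q x} e
... | inj₁ qx = x , qx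
... | inj₂ rest = any-elim q xs rest

any-intro : ∀ {A : Set} (q : A → Bool) {x} xs → x ∈ xs → q x ≡ true → any q xs ≡ true
any-intro q (y ∷ ys) (here refl) qx = ∨-introˡ _ qx
any-intro q (y ∷ ys) (there x∈) qx = ∨-introʳ (q y) (any-intro q ys x∈ qx)

any-false : ∀ {A : Set} (q : A → Bool) xs → (∀ x → q x ≡ false) → any q xs ≡ false
any-false q [] _ = refl
any-false q (x ∷ xs) none rewrite none x = any-false q xs none

leastVertex : ∀ {n} (q : Fin n → Bool) v → q v ≡ true →
  ∃ λ m → q m ≡ true × (∀ u → toℕ u < toℕ m → q u ≡ false)
leastVertex {suc n} q v qv with q zero in q0
... | true = zero , q0 , λ u ()
leastVertex {suc n} q zero qv | false = ⊥-elim (false≢true (trans (sym q0) qv))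
leastVertex {suc n} q (suc v) qv | false with leastVertex (q ∘ suc) v qv
... | m , qm , below = suc m , qm , λ { zero _ → q0 ; (suc u) u<m → below u (s≤s⁻¹ u<m) }

leastNat : ∀ (q : ℕ → Bool) t → q t ≡ true → ∃ λ m → q m ≡ true × (∀ s → s < m → q s ≡ false)
leastNat q t qt with q 0 in q0
... | true = 0 , q0 , λ s ()
leastNat q zero qt | false = ⊥-elim (false≢true (trans (sym q0) qt))
leastNat q (suc t) qt | false with leastNat (q ∘ suc) t qt
... | m , qm , below = suc m , qm , λ { zero _ → q0 ; (suc s) s<m → below s (s≤s⁻¹ s<m) }

count : ∀ {A : Set} → (A → Bool) → List A → ℕ
count q xs = sum (map (λ x → if q x then 1 else 0) xs)

count-≤-cons : ∀ {A : Set} (q : A → Bool) x xs → count q xs ≤ count q (x ∷ xs)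
count-≤-cons q x xs with q x
... | true = n≤1+n _
... | false = ≤-refl

count-positive : ∀ {A : Set} (q : A → Bool) {x} {xs} → x ∈ xs → q x ≡ true → 1 ≤ count q xs
count-positive q (here refl) qx rewrite qx = s≤s z≤n
count-positive q {xs = y ∷ ys} (there x∈) qx = ≤-trans (count-positive q x∈ qx) (count-≤-cons q y ys)

count-witness : ∀ {A : Set} (q : A → Bool) xs → 1 ≤ count q xs → ∃ λ x → q x ≡ true
count-witness q (x ∷ xs) pos with q x in qx
... | true = x , qx
... | false = count-witness q xs pos

count-lower : ∀ {A : Set} → DecidableEquality A → ∀ (q : A → Bool) xs {k} (f : Fin k → A) →
  Injective _≡_ _≡_ f → (∀ j → f j ∈ xs) → (∀ j → q (f j) ≡ true) → k ≤ count q xs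
count-lower _≟A_ q [] {zero} f _ _ _ = z≤n
count-lower _≟A_ q [] {suc k} f _ f∈ _ with f∈ zero
... | ()
count-lower _≟A_ q (x ∷ xs) {k} f inj f∈ qf with any? (λ j → f j ≟A x)
... | no x∉f = ≤-trans (count-lower _≟A_ q xs f inj f∈xs qf) (count-≤-cons q x xs)
  where
  f∈xs : ∀ j → f j ∈ xs
  f∈xs j with f∈ j
  ... | here fj≡x = ⊥-elim (x∉f (j , fj≡x))
  ... | there fj∈ = fj∈
count-lower _≟A_ q (x ∷ xs) {suc k} f inj f∈ qf | yes (i , fi≡x)
  rewrite trans (cong q (sym fi≡x)) (qf i) =
  s≤s (count-lower _≟A_ q xs (f ∘ punchIn i) (punchIn-injective i _ _ ∘ inj) others∈ (qf ∘ punchIn i))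
  where
  others∈ : ∀ j → f (punchIn i j) ∈ xs
  others∈ j with f∈ (punchIn i j)
  ... | here e = ⊥-elim (punchInᵢ≢i i j (inj (trans e (sym fi≡x))))
  ... | there e∈ = e∈

count-upper : ∀ {A : Set} (q : A → Bool) xs → Unique xs → ∀ {k} (f : Fin k → A) →
  (∀ x → x ∈ xs → q x ≡ true → ∃ λ j → x ≡ f j) → count q xs ≤ k
count-upper q [] _ f _ = z≤n
count-upper q (x ∷ xs) (x∉xs ∷ uniq) {k} f cover with q x in qx
... | false = count-upper q xs uniq f (λ y y∈ → cover y (there y∈))
count-upper q (x ∷ xs) (x∉xs ∷ uniq) {zero} f cover | true with cover x (here refl) qx
... | () , _
count-upper q (x ∷ xs) (x∉xs ∷ uniq) {suc k} f cover | true with cover x (here refl) qx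
... | i , x≡fi = s≤s (count-upper q xs uniq (f ∘ punchIn i) cover′)
  where
  cover′ : ∀ y → y ∈ xs → q y ≡ true → ∃ λ j → y ≡ f (punchIn i j)
  cover′ y y∈ qy with cover y (there y∈) qy
  ... | j , y≡fj with i ≟ j
  ... | yes refl = ⊥-elim (lookupAll x∉xs y∈ (trans x≡fi (sym y≡fj)))
  ... | no i≢j = punchOut i≢j , trans y≡fj (cong f (sym (punchIn-punchOut i≢j)))

countTrue-suc : ∀ {n} (p : Fin (suc n) → Bool) →
  countTrue p ≡ (if p zero then 1 else 0) + countTrue (p ∘ suc)
countTrue-suc {n} p = cong ((if p zero then 1 else 0) +_)
  (cong sum (trans (map-tabulate suc indicator) (sym (map-tabulate id (indicator ∘ suc)))))
  where
  indicator : Fin (suc n) → ℕ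
  indicator v = if p v then 1 else 0

countTrue-lower : ∀ {n k} (p : Fin n → Bool) (f : Fin k → Fin n) →
  Injective _≡_ _≡_ f → (∀ j → p (f j) ≡ true) → k ≤ countTrue p
countTrue-lower p f inj pf = count-lower _≟_ p (allFin _) f inj (λ j → ∈-allFin (f j)) pf

countTrue-upper : ∀ {n k} (p : Fin n → Bool) (f : Fin k → Fin n) →
  (∀ v → p v ≡ true → ∃ λ j → v ≡ f j) → countTrue p ≤ k
countTrue-upper p f cover = count-upper p (allFin _) (Unique.allFin⁺ _) f (λ v _ → cover v)

countTrue-≤1 : ∀ {n} (p : Fin n → Bool) → (∀ u v → p u ≡ true → p v ≡ true → u ≡ v) → countTrue p ≤ 1
countTrue-≤1 p unique with any? (λ v → p v ≟ᵇ true)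
... | yes (a , pa) = countTrue-upper p (λ _ → a) (λ v pv → zero , unique v a pv pa)
... | no none = ≤-trans (countTrue-upper p (λ ()) (λ v pv → ⊥-elim (none (v , pv)))) z≤n

countTrue≤1⇒unique : ∀ {n} (p : Fin n → Bool) → countTrue p ≤ 1 →
  ∀ {a b} → p a ≡ true → p b ≡ true → a ≡ b
countTrue≤1⇒unique {n} p atMostOne {a} {b} pa pb with a ≟ b
... | yes a≡b = a≡b
... | no a≢b = ⊥-elim (1+n≰n (≤-trans (countTrue-lower p ab ab-injective ab-true) atMostOne))
  where
  ab : Fin 2 → Fin n
  ab zero = a
  ab (suc _) = b
  ab-injective : Injective _≡_ _≡_ ab
  ab-injective {zero} {zero} _ = refl
  ab-injective {zero} {suc zero} a≡b = ⊥-elim (a≢b a≡b)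
  ab-injective {suc zero} {zero} b≡a = ⊥-elim (a≢b (sym b≡a))
  ab-injective {suc zero} {suc zero} _ = refl
  ab-true : ∀ j → p (ab j) ≡ true
  ab-true zero = pa
  ab-true (suc zero) = pb

injective⇒surjective : ∀ {n} (f : Fin n → Fin n) → Injective _≡_ _≡_ f → ∀ c → ∃ λ v → f v ≡ c
injective⇒surjective {suc n} f inj c with any? (λ v → f v ≟ c)
... | yes hit = hit
... | no miss = ⊥-elim (1+n≰n (injective⇒≤ {f = λ v → punchOut (avoid v)}
                                 (λ e → inj (punchOut-injective (avoid _) (avoid _) e))))
  where
  avoid : ∀ v → c ≢ f v
  avoid v c≡fv = miss (v , sym c≡fv)

isomorphism-from-injection : ∀ {n} (G H : Graph n) (f : Fin n → Fin n) → Injective _≡_ _≡_ f →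
  (∀ u v → adj G u v ≡ adj H (f u) (f v)) → G ≅ H
isomorphism-from-injection G H f inj preserves =
  mk↔ₛ′ f (λ c → proj₁ (onto c)) (λ c → proj₂ (onto c)) (λ v → inj (proj₂ (onto (f v)))) , preserves
  where
  onto : ∀ c → ∃ λ v → f v ≡ c
  onto = injective⇒surjective f inj

-- Walks in the induced subgraph G[X].

module Walks {n} (G : Graph n) (X : Subset n) where

  -- The endpoints and length are explicit throughout: walkWithin computes
  -- on its length, so they cannot be recovered from a walk's type.
  walk : ℕ → Fin n → Fin n → Bool
  walk = walkWithin G X

  walk-zero-elim : ∀ u v → walk 0 u v ≡ true → inS X u ≡ true × u ≡ v
  walk-zero-elim u v e with ∧-elim e
  ... | u∈X , u=v = u∈X , ==-sound u=v

  walk-suc-elim : ∀ t u v → walk (suc t) u v ≡ true →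
    walk t u v ≡ true ⊎ ∃ λ w → walk t u w ≡ true × adj G w v ≡ true × inS X v ≡ true
  walk-suc-elim t u v e with ∨-elim e
  ... | inj₁ shorter = inj₁ shorter
  ... | inj₂ viaEdge with any-elim _ (allFin n) viaEdge
  ... | w , step with ∧-elim step
  ... | uw , last with ∧-elim last
  ... | wv , v∈X = inj₂ (w , uw , wv , v∈X)

  walk-endpoints : ∀ t u v → walk t u v ≡ true → inS X u ≡ true × inS X v ≡ true
  walk-endpoints zero u v e with walk-zero-elim u v e
  ... | u∈X , refl = u∈X , u∈X
  walk-endpoints (suc t) u v e with walk-suc-elim t u v e
  ... | inj₁ shorter = walk-endpoints t u v shorter
  ... | inj₂ (w , uw , _ , v∈X) = proj₁ (walk-endpoints t u w uw) , v∈X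

  walk-weaken : ∀ t u v → walk t u v ≡ true → walk (suc t) u v ≡ true
  walk-weaken t u v = ∨-introˡ _

  walk-extend : ∀ s t u v → walk t u v ≡ true → walk (s + t) u v ≡ true
  walk-extend zero t u v e = e
  walk-extend (suc s) t u v e = walk-weaken (s + t) u v (walk-extend s t u v e)

  walk-refl : ∀ t u → inS X u ≡ true → walk t u u ≡ true
  walk-refl zero u u∈X = cong₂ _∧_ u∈X (==-refl u)
  walk-refl (suc t) u u∈X = walk-weaken t u u (walk-refl t u u∈X)

  walk-snoc : ∀ t u w v → walk t u w ≡ true → adj G w v ≡ true → inS X v ≡ true → walk (suc t) u v ≡ true
  walk-snoc t u w v uw wv v∈X =
    ∨-introʳ (walk t u v) (any-intro _ (allFin n) (∈-allFin w) (cong₂ _∧_ uw (cong₂ _∧_ wv v∈X)))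

  walk-append : ∀ s t u w v → walk t u w ≡ true → walk s w v ≡ true → walk (s + t) u v ≡ true
  walk-append zero t u w v uw wv with walk-zero-elim w v wv
  ... | _ , refl = uw
  walk-append (suc s) t u w v uw wv with walk-suc-elim s w v wv
  ... | inj₁ shorter = walk-weaken (s + t) u v (walk-append s t u w v uw shorter)
  ... | inj₂ (z , wz , zv , v∈X) = walk-snoc (s + t) u z v (walk-append s t u w z uw wz) zv v∈X

  walk-edge : ∀ u v → inS X u ≡ true → inS X v ≡ true → adj G u v ≡ true → walk 1 u v ≡ true
  walk-edge u v u∈X v∈X uv = walk-snoc 0 u u v (walk-refl 0 u u∈X) uv v∈X

  walk-reverse : ∀ t u v → walk t u v ≡ true → walk t v u ≡ true
  walk-reverse zero u v e with walk-zero-elim u v e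
  ... | _ , refl = e
  walk-reverse (suc t) u v e with walk-suc-elim t u v e
  ... | inj₁ shorter = walk-weaken t v u (walk-reverse t u v shorter)
  ... | inj₂ (w , uw , wv , v∈X) = subst (λ s → walk s v u ≡ true) (+-comm t 1)
        (walk-append t 1 v w u (walk-edge v w v∈X (proj₂ (walk-endpoints t u w uw)) (trans (adj-sym G v w) wv))
                               (walk-reverse t u w uw))

EdgeInvariant : ∀ {n} {A : Set} → Graph n → Subset n → (Fin n → A) → Set
EdgeInvariant G X f = ∀ a b → inS X a ≡ true → inS X b ≡ true → adj G a b ≡ true → f a ≡ f b

walk-invariant : ∀ {n} {A : Set} (G : Graph n) X (f : Fin n → A) → EdgeInvariant G X f →
  ∀ t u v → walkWithin G X t u v ≡ true → f u ≡ f v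
walk-invariant G X f inv zero u v e with Walks.walk-zero-elim G X u v e
... | _ , refl = refl
walk-invariant G X f inv (suc t) u v e with Walks.walk-suc-elim G X t u v e
... | inj₁ shorter = walk-invariant G X f inv t u v shorter
... | inj₂ (w , uw , wv , v∈X) =
  trans (walk-invariant G X f inv t u w uw) (inv w v (proj₂ (Walks.walk-endpoints G X t u w uw)) v∈X wv)

adjacent⇒distinct : ∀ {n} (G : Graph n) {a b} → adj G a b ≡ true → a ≢ b
adjacent⇒distinct G {a} ab refl = false≢true (trans (sym (adj-irrefl G a)) ab)

adjacent⇒connected : ∀ {n} (G : Graph n) X {u v} →
  inS X u ≡ true → inS X v ≡ true → adj G u v ≡ true → connectedIn G X u v ≡ true
adjacent⇒connected {zero} G X {()}
adjacent⇒connected {suc n} G X {u} {v} u∈X v∈X uv =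
  subst (λ t → walkWithin G X t u v ≡ true) (+-comm n 1) (Walks.walk-extend G X n 1 u v (Walks.walk-edge G X u v u∈X v∈X uv))

leader : ∀ {n} → Graph n → Subset n → Fin n → Bool
leader {n} G X v = inS X v ∧ not (any (λ u → (toℕ u <ᵇ toℕ v) ∧ connectedIn G X u v) (allFin n))

not-leader : ∀ {n} (G : Graph n) X {u v} → toℕ u < toℕ v → connectedIn G X u v ≡ true → leader G X v ≡ false
not-leader {n} G X {u} {v} u<v uv with inS X v
... | false = refl
... | true = cong not (any-intro _ (allFin n) (∈-allFin u) (cong₂ _∧_ (<ᵇ-complete u<v) uv))

non-leader-elim : ∀ {n} (G : Graph n) X {v} → inS X v ≡ true → leader G X v ≡ false →
  ∃ λ u → toℕ u < toℕ v × connectedIn G X u v ≡ true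
non-leader-elim {n} G X v∈X notLeader with any-elim _ (allFin n) (∧-not-false v∈X notLeader)
... | u , e with ∧-elim e
... | u<v , uv = u , <ᵇ-sound u<v , uv

-- If f is edge-invariant on G[X] and takes each value 0,…,k-1 on X, then
-- G[X] has at least k components: the least vertex of X with value j is a
-- leader, and different j give different leaders.
components-≥ : ∀ {n k} (G : Graph n) X (f : Fin n → ℕ) → EdgeInvariant G X f →
  (∀ (j : Fin k) → ∃ λ v → inS X v ≡ true × f v ≡ toℕ j) → k ≤ components G X
components-≥ {n} {k} G X f inv values = countTrue-lower (leader G X) rep rep-injective rep-leader
  where
  inClass : Fin k → Fin n → Bool
  inClass j v = inS X v ∧ (f v ≡ᵇ toℕ j)

  least : ∀ j → ∃ λ m → inClass j m ≡ true × (∀ u → toℕ u < toℕ m → inClass j u ≡ false)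
  least j with values j
  ... | v , v∈X , fv = leastVertex (inClass j) v (cong₂ _∧_ v∈X (≡ᵇ-complete fv))

  rep : Fin k → Fin n
  rep j = proj₁ (least j)

  rep-in-class : ∀ j → inS X (rep j) ≡ true × f (rep j) ≡ toℕ j
  rep-in-class j with ∧-elim (proj₁ (proj₂ (least j)))
  ... | r∈X , fr = r∈X , ≡ᵇ-sound fr

  rep-injective : Injective _≡_ _≡_ rep
  rep-injective {i} {j} ri≡rj =
    toℕ-injective (trans (sym (proj₂ (rep-in-class i))) (trans (cong f ri≡rj) (proj₂ (rep-in-class j))))

  rep-leader : ∀ j → leader G X (rep j) ≡ true
  rep-leader j = cong₂ _∧_ (proj₁ (rep-in-class j)) (cong not (any-false _ (allFin n) no-smaller))
    where
    no-smaller : ∀ u → ((toℕ u <ᵇ toℕ (rep j)) ∧ connectedIn G X u (rep j)) ≡ false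
    no-smaller u = ¬true⇒false λ e → let (u<r , ur) = ∧-elim e in
      false≢true (trans (sym (proj₂ (proj₂ (least j)) u (<ᵇ-sound u<r)))
        (cong₂ _∧_ (proj₁ (Walks.walk-endpoints G X n u (rep j) ur))
          (≡ᵇ-complete (trans (walk-invariant G X f inv n u (rep j) ur) (proj₂ (rep-in-class j))))))

components-nonempty : ∀ {n} (G : Graph n) X {v} → inS X v ≡ true → 1 ≤ components G X
components-nonempty G X {v} v∈X = components-≥ G X (λ _ → 0) (λ _ _ _ _ _ → refl) λ { zero → v , v∈X , refl }

inS-⊤ : ∀ {n} (v : Fin n) → inS ⊤ v ≡ true
inS-⊤ v = lookup-replicate v true

leader-zero : ∀ {k} (G : Graph (suc k)) X → inS X zero ≡ true → leader G X zero ≡ true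
leader-zero {k} G X 0∈X = cong₂ _∧_ 0∈X (cong not (any-false _ (allFin (suc k)) (λ _ → refl)))

-- If G has one component, every vertex w is reachable from 0: for w ≠ 0 the
-- unique leader is 0, so w is connected to a smaller vertex (recursion on
-- toℕ w, with fuel).
reachable-from-0 : ∀ {k} (G : Graph (suc k)) → components G ⊤ ≡ 1 →
  ∀ fuel w → toℕ w < fuel → ∃ λ t → walkWithin G ⊤ t zero w ≡ true
reachable-from-0 {k} G one (suc fuel) w w<fuel with w ≟ zero
... | yes refl = 0 , Walks.walk-refl G ⊤ 0 zero (inS-⊤ w)
... | no w≢0 with non-leader-elim G ⊤ (inS-⊤ w) (¬true⇒false λ lw →
                    w≢0 (countTrue≤1⇒unique (leader G ⊤) (≤-reflexive one) lw (leader-zero G ⊤ (inS-⊤ {suc k} zero))))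
... | x , x<w , xw with reachable-from-0 G one fuel x (≤-trans x<w (s≤s⁻¹ w<fuel))
... | t , 0x = suc k + t , Walks.walk-append G ⊤ (suc k) t zero x w 0x xw

connected : ∀ {k} (G : Graph (suc k)) → components G ⊤ ≡ 1 →
  ∀ u v → ∃ λ t → walkWithin G ⊤ t u v ≡ true
connected {k} G one u v =
  let (t , 0u) = reachable-from-0 G one (suc k) u (toℕ<n u)
      (s , 0v) = reachable-from-0 G one (suc k) v (toℕ<n v)
  in s + t , Walks.walk-append G ⊤ s t u zero v (Walks.walk-reverse G ⊤ t zero u 0u) 0v

without : ∀ {n} → Fin n → Subset n
without zero = false ∷ ⊤
without (suc r) = true ∷ without r

without-self : ∀ {n} (r : Fin n) → inS (without r) r ≡ false
without-self zero = refl
without-self (suc r) = without-self r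

without-other : ∀ {n} (r v : Fin n) → v ≢ r → inS (without r) v ≡ true
without-other zero zero v≢r = ⊥-elim (v≢r refl)
without-other zero (suc v) _ = inS-⊤ v
without-other (suc r) zero _ = refl
without-other (suc r) (suc v) v≢r = without-other r v (v≢r ∘ cong suc)

without-excluded : ∀ {n} (r v : Fin n) → inS (without r) v ≡ false → v ≡ r
without-excluded r v v∉ with v ≟ r
... | yes v≡r = v≡r
... | no v≢r = ⊥-elim (false≢true (trans (sym v∉) (without-other r v v≢r)))

∣without∣ : ∀ {n} (r : Fin (suc n)) → ∣ without r ∣ ≡ n
∣without∣ {n} zero = ∣⊤∣≡n n
∣without∣ {suc n} (suc r) = cong suc (∣without∣ r)

size-pred-inv : ∀ {n} (X : Subset (suc n)) → ∣ X ∣ ≡ n → ∃ λ r → X ≡ without r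
size-pred-inv (false ∷ X) size = zero , cong (false ∷_) (∣p∣≡n⇒p≡⊤ size)
size-pred-inv {zero} (true ∷ []) ()
size-pred-inv {suc n} (true ∷ X) size with size-pred-inv X (suc-injective size)
... | r , refl = suc r , refl

pair : ∀ {n} → Fin n → Fin n → Subset n
pair a b = tabulate (λ w → (w == a) ∨ (w == b))

inS-pair : ∀ {n} (a b w : Fin n) → inS (pair a b) w ≡ (w == a) ∨ (w == b)
inS-pair a b w = lookup∘tabulate _ w

pair-left : ∀ {n} (a b : Fin n) → inS (pair a b) a ≡ true
pair-left a b = trans (inS-pair a b a) (∨-introˡ _ (==-refl a))

pair-right : ∀ {n} (a b : Fin n) → inS (pair a b) b ≡ true
pair-right a b = trans (inS-pair a b b) (∨-introʳ (b == a) (==-refl b))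

pair-members : ∀ {n} (a b w : Fin n) → inS (pair a b) w ≡ true → w ≡ a ⊎ w ≡ b
pair-members a b w w∈ with ∨-elim {w == a} (trans (sym (inS-pair a b w)) w∈)
... | inj₁ w=a = inj₁ (==-sound w=a)
... | inj₂ w=b = inj₂ (==-sound w=b)

pair-comm : ∀ {n} (a b : Fin n) → pair a b ≡ pair b a
pair-comm a b = tabulate-cong (λ w → ∨-comm (w == a) (w == b))

pair-injective : ∀ {n} (a b c d : Fin n) → a ≢ b → pair a b ≡ pair c d → (a ≡ c × b ≡ d) ⊎ (a ≡ d × b ≡ c)
pair-injective a b c d a≢b ab≡cd
  with pair-members c d a (subst (λ X → inS X a ≡ true) ab≡cd (pair-left a b))
     | pair-members c d b (subst (λ X → inS X b ≡ true) ab≡cd (pair-right a b))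
... | inj₁ refl | inj₁ refl = ⊥-elim (a≢b refl)
... | inj₁ refl | inj₂ refl = inj₁ (refl , refl)
... | inj₂ refl | inj₁ refl = inj₂ (refl , refl)
... | inj₂ refl | inj₂ refl = ⊥-elim (a≢b refl)

∣∅∣≡0 : ∀ n → ∣ tabulate {n = n} (λ _ → false) ∣ ≡ 0
∣∅∣≡0 zero = refl
∣∅∣≡0 (suc n) = ∣∅∣≡0 n

∣single∣≡1 : ∀ {n} (a : Fin n) → ∣ tabulate (_== a) ∣ ≡ 1
∣single∣≡1 {suc n} zero = cong suc (∣∅∣≡0 n)
∣single∣≡1 (suc a) = ∣single∣≡1 a

∣pair∣≡2 : ∀ {n} {a b : Fin n} → a ≢ b → ∣ pair a b ∣ ≡ 2
∣pair∣≡2 {a = zero} {zero} a≢b = ⊥-elim (a≢b refl)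
∣pair∣≡2 {a = zero} {suc b} _ = cong suc (∣single∣≡1 b)
∣pair∣≡2 {a = suc a} {zero} a≢b = trans (cong ∣_∣ (pair-comm (suc a) zero)) (∣pair∣≡2 (a≢b ∘ sym))
∣pair∣≡2 {a = suc a} {suc b} a≢b = ∣pair∣≡2 (a≢b ∘ cong suc)

size-zero-inv : ∀ {n} (X : Subset n) → ∣ X ∣ ≡ 0 → X ≡ tabulate (λ _ → false)
size-zero-inv [] _ = refl
size-zero-inv (false ∷ X) size = cong (false ∷_) (size-zero-inv X size)

size-one-inv : ∀ {n} (X : Subset n) → ∣ X ∣ ≡ 1 → ∃ λ a → X ≡ tabulate (_== a)
size-one-inv (false ∷ X) size with size-one-inv X size
... | a , refl = suc a , refl
size-one-inv (true ∷ X) size with size-zero-inv X (suc-injective size)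
... | refl = zero , refl

size-two-inv : ∀ {n} (X : Subset n) → ∣ X ∣ ≡ 2 → ∃₂ λ a b → toℕ a < toℕ b × X ≡ pair a b
size-two-inv (false ∷ X) size with size-two-inv X size
... | a , b , a<b , refl = suc a , suc b , s≤s a<b , refl
size-two-inv (true ∷ X) size with size-one-inv X (suc-injective size)
... | b , refl = zero , suc b , s≤s z≤n , refl

components-ordered-edge : ∀ {n} (G : Graph n) {a b} → toℕ a < toℕ b → adj G a b ≡ true → components G (pair a b) ≡ 1
components-ordered-edge G {a} {b} a<b ab =
  ≤-antisym (countTrue-upper (leader G (pair a b)) (λ (_ : Fin 1) → a) only-a) (components-nonempty G (pair a b) (pair-left a b))
  where
  b-not-leader : leader G (pair a b) b ≡ false
  b-not-leader = not-leader G (pair a b) a<b (adjacent⇒connected G (pair a b) (pair-left a b) (pair-right a b) ab)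
  only-a : ∀ v → leader G (pair a b) v ≡ true → ∃ λ (_ : Fin 1) → v ≡ a
  only-a v lv with pair-members a b v (proj₁ (∧-elim lv))
  ... | inj₁ v≡a = zero , v≡a
  ... | inj₂ refl = ⊥-elim (false≢true (trans (sym b-not-leader) lv))

components-edge : ∀ {n} (G : Graph n) {a b} → adj G a b ≡ true → components G (pair a b) ≡ 1
components-edge G {a} {b} ab with <-cmp (toℕ a) (toℕ b)
... | tri< a<b _ _ = components-ordered-edge G a<b ab
... | tri≈ _ a≡b _ = ⊥-elim (adjacent⇒distinct G ab (toℕ-injective a≡b))
... | tri> _ _ b<a = trans (cong (components G) (pair-comm a b)) (components-ordered-edge G b<a (trans (adj-sym G b a) ab))

components-non-edge : ∀ {n} (G : Graph n) {a b} → a ≢ b → adj G a b ≡ false → 2 ≤ components G (pair a b)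
components-non-edge {n} G {a} {b} a≢b nonadj = components-≥ G (pair a b) side invariant values
  where
  side : Fin n → ℕ
  side v = if v == a then 0 else 1
  invariant : EdgeInvariant G (pair a b) side
  invariant x y x∈ y∈ xy with pair-members a b x x∈ | pair-members a b y y∈
  ... | inj₁ refl | inj₁ refl = refl
  ... | inj₂ refl | inj₂ refl = refl
  ... | inj₁ refl | inj₂ refl = ⊥-elim (false≢true (trans (sym nonadj) xy))
  ... | inj₂ refl | inj₁ refl = ⊥-elim (false≢true (trans (sym nonadj) (trans (adj-sym G a b) xy)))
  values : ∀ (j : Fin 2) → ∃ λ v → inS (pair a b) v ≡ true × side v ≡ toℕ j
  values zero = a , pair-left a b , cong (if_then 0 else 1) (==-refl a)
  values (suc zero) = b , pair-right a b , cong (if_then 0 else 1) (==-false (a≢b ∘ sym))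

Qpred : ∀ {m} → Graph m → ℕ → ℕ → Subset m → Bool
Qpred G i j X = (∣ X ∣ ≡ᵇ i) ∧ (components G X ≡ᵇ j)

Qpred-intro : ∀ {m} (G : Graph m) {i j} X → ∣ X ∣ ≡ i → components G X ≡ j → Qpred G i j X ≡ true
Qpred-intro G X size comps = cong₂ _∧_ (≡ᵇ-complete size) (≡ᵇ-complete comps)

Qpred-elim : ∀ {m} (G : Graph m) {i j} X → Qpred G i j X ≡ true → ∣ X ∣ ≡ i × components G X ≡ j
Qpred-elim G X QX with ∧-elim QX
... | size , comps = ≡ᵇ-sound size , ≡ᵇ-sound comps

edge-Qpred : ∀ {n} (G : Graph n) {u v} → adj G u v ≡ true → Qpred G 2 1 (pair u v) ≡ true
edge-Qpred G uv = Qpred-intro G (pair _ _) (∣pair∣≡2 (adjacent⇒distinct G uv)) (components-edge G uv)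

allSubsets-complete : ∀ {m} (X : Subset m) → X ∈ allSubsets m
allSubsets-complete [] = here refl
allSubsets-complete {suc m} (false ∷ X) = ∈-++⁺ˡ (∈-map⁺ (false ∷_) (allSubsets-complete X))
allSubsets-complete {suc m} (true ∷ X) =
  ∈-++⁺ʳ (map (false ∷_) (allSubsets m)) (∈-map⁺ (true ∷_) (allSubsets-complete X))

allSubsets-unique : ∀ m → Unique (allSubsets m)
allSubsets-unique zero = [] ∷ []
allSubsets-unique (suc m) =
  Unique.++⁺ (Unique.map⁺ ∷-injectiveʳ (allSubsets-unique m)) (Unique.map⁺ ∷-injectiveʳ (allSubsets-unique m)) disjoint
  where
  ∷-injectiveʳ : ∀ {b} {X Y : Subset m} → _≡_ {A = Subset (suc m)} (b ∷ X) (b ∷ Y) → X ≡ Y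
  ∷-injectiveʳ refl = refl
  disjoint : ∀ {X} → ¬ (X ∈ map (false ∷_) (allSubsets m) × X ∈ map (true ∷_) (allSubsets m))
  disjoint (X∈₀ , X∈₁) with ∈-map⁻ (false ∷_) X∈₀ | ∈-map⁻ (true ∷_) X∈₁
  ... | _ , _ , refl | _ , _ , ()

≡Q-sym : ∀ {m n} (G : Graph m) (H : Graph n) → G ≡Q H → H ≡Q G
≡Q-sym G H q i j = sym (q i j)

Q-transfer : ∀ {m n} (G : Graph m) (H : Graph n) → G ≡Q H →
  ∀ X {i j} → ∣ X ∣ ≡ i → components G X ≡ j → ∃ λ Y → ∣ Y ∣ ≡ i × components H Y ≡ j
Q-transfer {n = n} G H q X {i} {j} size comps
  with count-witness (Qpred H i j) (allSubsets n)
         (subst (1 ≤_) (q i j) (count-positive (Qpred G i j) (allSubsets-complete X) (Qpred-intro G X size comps)))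
... | Y , QY = Y , Qpred-elim H Y QY

Q-vertices : ∀ {m n} (G : Graph m) (H : Graph n) → G ≡Q H → m ≡ n
Q-vertices G H q = ≤-antisym (bound G H q) (bound H G (≡Q-sym G H q))
  where
  bound : ∀ {m n} (G : Graph m) (H : Graph n) → G ≡Q H → m ≤ n
  bound {m} G H q with Q-transfer G H q ⊤ (∣⊤∣≡n m) refl
  ... | Y , size , _ = subst (_≤ _) size (∣p∣≤n Y)

-- Facts about the path P_{k+1}.

P-step : ∀ {k} (v : Fin k) → adj (P (suc k)) (inject₁ v) (suc v) ≡ true
P-step v rewrite toℕ-inject₁ v = ∨-introˡ _ (≡ᵇ-complete {suc (toℕ v)} refl)

P-leader : ∀ {k} (X : Subset (suc k)) (v : Fin k) → leader (P (suc k)) X (suc v) ≡ true → inS X (inject₁ v) ≡ false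
P-leader X v lv = ¬true⇒false λ pred∈X →
  false≢true (trans (sym (not-leader (P _) X pred<v (adjacent⇒connected (P _) X pred∈X (proj₁ (∧-elim lv)) (P-step v)))) lv)
  where
  pred<v : toℕ (inject₁ v) < toℕ (suc v)
  pred<v = s≤s (≤-reflexive (toℕ-inject₁ v))

P-initial-segment : ∀ {k} (X : Subset (suc k)) → inS X zero ≡ true →
  (∀ v → inS X (suc v) ≡ true → inS X (inject₁ v) ≡ true) → components (P (suc k)) X ≡ 1
P-initial-segment X 0∈X closed =
  ≤-antisym (countTrue-upper (leader (P _) X) (λ (_ : Fin 1) → zero) only-zero) (components-nonempty (P _) X 0∈X)
  where
  only-zero : ∀ v → leader (P _) X v ≡ true → ∃ λ (_ : Fin 1) → v ≡ zero
  only-zero zero _ = zero , refl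
  only-zero (suc v) lv = ⊥-elim (false≢true (trans (sym (P-leader X v lv)) (closed v (proj₁ (∧-elim lv)))))

P-minus-last : ∀ k → components (P (suc (suc k))) (without (fromℕ (suc k))) ≡ 1
P-minus-last k = P-initial-segment {suc k} (without (fromℕ (suc k))) refl
  (λ v _ → without-other (fromℕ (suc k)) (inject₁ v) (λ e → fromℕ≢inject₁ (sym e)))

-- In P minus r, only the successor of r can be a leader besides 0.
P-nonzero-leaders : ∀ {k} (r : Fin (suc k)) → countTrue (leader (P (suc k)) (without r) ∘ suc) ≤ 1
P-nonzero-leaders {k} r = countTrue-≤1 (leader (P (suc k)) (without r) ∘ suc) λ u v lu lv →
  inject₁-injective (trans (without-excluded r _ (P-leader (without r) u lu)) (sym (without-excluded r _ (P-leader (without r) v lv))))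

indicator≤1 : ∀ b → (if b then 1 else 0) ≤ 1
indicator≤1 true = ≤-refl
indicator≤1 false = z≤n

P-deletion : ∀ {k} (X : Subset (suc k)) → ∣ X ∣ ≡ k → components (P (suc k)) X ≤ 2
P-deletion {k} X size with size-pred-inv X size
... | r , refl = subst (_≤ 2) (sym (countTrue-suc (leader (P (suc k)) (without r))))
                   (+-mono-≤ (indicator≤1 _) (P-nonzero-leaders r))

P-adjacent-succ : ∀ {n} {a b : Fin n} → toℕ a < toℕ b → adj (P n) a b ≡ true → toℕ b ≡ suc (toℕ a)
P-adjacent-succ a<b ab with ∨-elim ab
... | inj₁ e = sym (≡ᵇ-sound e)
... | inj₂ e = ⊥-elim (<-asym a<b (≤-reflexive (≡ᵇ-sound e)))

successor-form : ∀ {k} {a b : Fin (suc k)} → toℕ b ≡ suc (toℕ a) → ∃ λ i → a ≡ inject₁ i × b ≡ suc i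
successor-form {b = zero} ()
successor-form {b = suc i} e = i , toℕ-injective (trans (sym (suc-injective e)) (sym (toℕ-inject₁ i))) , refl

P-connected-pair : ∀ {k} {a b : Fin (suc k)} → toℕ a < toℕ b → components (P (suc k)) (pair a b) ≡ 1 →
  ∃ λ i → a ≡ inject₁ i × b ≡ suc i
P-connected-pair {k} {a} {b} a<b one = successor-form (P-adjacent-succ a<b adjacent)
  where
  adjacent : adj (P (suc k)) a b ≡ true
  adjacent = ¬false⇒true λ nonadj →
    1+n≰n (≤-trans (components-non-edge (P (suc k)) (<⇒≢ a<b) nonadj) (≤-reflexive one))

P-edge-count : ∀ k → Qcoeff (P (suc k)) 2 1 ≤ k
P-edge-count k = count-upper (Qpred (P (suc k)) 2 1) (allSubsets (suc k)) (allSubsets-unique (suc k)) consecutive cover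
  where
  consecutive : Fin k → Subset (suc k)
  consecutive i = pair (inject₁ i) (suc i)
  cover : ∀ X → X ∈ allSubsets (suc k) → Qpred (P (suc k)) 2 1 X ≡ true → ∃ λ i → X ≡ consecutive i
  cover X _ QX with Qpred-elim (P (suc k)) X QX
  ... | size , one with size-two-inv X size
  ... | a , b , a<b , refl with P-connected-pair a<b one
  ... | i , refl , refl = i , refl

-- What Q(H) = Q(P_{k+1}) tells us about H.  These proofs use let rather than
-- with: with-abstraction in the presence of q would normalise Q(P_{k+1}).

H-connected : ∀ {k} (H : Graph (suc k)) → H ≡Q P (suc k) → components H ⊤ ≡ 1
H-connected {k} H q =
  let (Y , size , one) = Q-transfer (P (suc k)) H (≡Q-sym H (P (suc k)) q) ⊤ (∣⊤∣≡n (suc k))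
                           (P-initial-segment {k} ⊤ (inS-⊤ {suc k} zero) (λ v _ → inS-⊤ (inject₁ v)))
  in trans (cong (components H) (sym (∣p∣≡n⇒p≡⊤ size))) one

H-cut : ∀ {k} (H : Graph (suc k)) → H ≡Q P (suc k) → ∀ v → components H (without v) ≤ 2
H-cut {k} H q v =
  let (Y , size , comps) = Q-transfer H (P (suc k)) q (without v) (∣without∣ v) refl
  in subst (_≤ 2) comps (P-deletion Y size)

H-leaf : ∀ {k} (H : Graph (suc k)) → H ≡Q P (suc k) → ∃ λ r → components H (without r) ≤ 1
H-leaf {zero} H q = zero , countTrue-≤1 (leader H (without zero)) (λ { zero zero _ _ → refl })
H-leaf {suc k} H q =
  let (Y , size , one) = Q-transfer (P (suc (suc k))) H (≡Q-sym H (P (suc (suc k))) q)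
                           (without (fromℕ (suc k))) (∣without∣ (fromℕ (suc k))) (P-minus-last k)
      (r , Y≡without) = size-pred-inv Y size
  in r , ≤-reflexive (trans (cong (components H) (sym Y≡without)) one)

module BFS {n} (G : Graph n) (r : Fin n) (reachable : ∀ v → ∃ λ t → walkWithin G ⊤ t r v ≡ true) where

  open Walks G ⊤

  shortest : ∀ v → ∃ λ d → walk d r v ≡ true × (∀ s → s < d → walk s r v ≡ false)
  shortest v = leastNat (λ t → walk t r v) (proj₁ (reachable v)) (proj₂ (reachable v))

  depth : Fin n → ℕ
  depth v = proj₁ (shortest v)

  depth-walk : ∀ v → walk (depth v) r v ≡ true
  depth-walk v = proj₁ (proj₂ (shortest v))

  depth-≤ : ∀ t v → walk t r v ≡ true → depth v ≤ t
  depth-≤ t v rv = ≮⇒≥ λ t<d → false≢true (trans (sym (proj₂ (proj₂ (shortest v)) t t<d)) rv)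

  depth-root : depth r ≡ 0
  depth-root = n≤0⇒n≡0 (depth-≤ 0 r (walk-refl 0 r (inS-⊤ r)))

  depth-zero : ∀ {v} → depth v ≡ 0 → v ≡ r
  depth-zero {v} d≡0 = sym (proj₂ (walk-zero-elim r v (subst (λ t → walk t r v ≡ true) d≡0 (depth-walk v))))

  nonroot : ∀ {v} → 0 < depth v → v ≢ r
  nonroot pos refl = <-irrefl (sym depth-root) pos

  depth-edge : ∀ {a b} → adj G a b ≡ true → depth b ≤ suc (depth a)
  depth-edge {a} {b} ab = depth-≤ (suc (depth a)) b (walk-snoc (depth a) r a b (depth-walk a) ab (inS-⊤ b))

  -- The last edge of a shortest walk to v ≠ r comes from a vertex one level up.
  predecessor : ∀ v → v ≢ r → ∃ λ w → adj G w v ≡ true × suc (depth w) ≡ depth v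
  predecessor v v≢r with depth v in d≡
  ... | zero = ⊥-elim (v≢r (depth-zero d≡))
  ... | suc t with walk-suc-elim t r v (subst (λ s → walk s r v ≡ true) d≡ (depth-walk v))
  ...   | inj₁ shorter = ⊥-elim (1+n≰n (≤-trans (≤-reflexive (sym d≡)) (depth-≤ t v shorter)))
  ...   | inj₂ (w , rw , wv , _) =
          w , wv , cong suc (≤-antisym (depth-≤ t w rw) (s≤s⁻¹ (≤-trans (≤-reflexive (sym d≡)) (depth-edge wv))))

  -- The parent of v ≠ r is its predecessor; the root is its own parent.
  parent : Fin n → Fin n
  parent v with v ≟ r
  ... | yes _ = r
  ... | no v≢r = proj₁ (predecessor v v≢r)

  parent-spec : ∀ v → v ≢ r → adj G (parent v) v ≡ true × suc (depth (parent v)) ≡ depth v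
  parent-spec v v≢r with v ≟ r
  ... | yes v≡r = ⊥-elim (v≢r v≡r)
  ... | no v≢r′ = proj₂ (predecessor v v≢r′)

  parent-adj : ∀ v → v ≢ r → adj G (parent v) v ≡ true
  parent-adj v v≢r = proj₁ (parent-spec v v≢r)

  parent-depth : ∀ v → v ≢ r → suc (depth (parent v)) ≡ depth v
  parent-depth v v≢r = proj₂ (parent-spec v v≢r)

  parent-shallower : ∀ v → v ≢ r → depth (parent v) < depth v
  parent-shallower v v≢r = ≤-reflexive (parent-depth v v≢r)

  parent-≢ : ∀ v → v ≢ r → parent v ≢ v
  parent-≢ v v≢r pv≡v = <-irrefl (cong depth pv≡v) (parent-shallower v v≢r)

  -- The ancestor of u at depth s (for s ≤ depth u).
  ancestorAt : ℕ → Fin n → Fin n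
  ancestorAt s u = iterate parent u (depth u ∸ s)

  depth-iterate : ∀ i v → i ≤ depth v → depth (iterate parent v i) ≡ depth v ∸ i
  depth-iterate zero v _ = refl
  depth-iterate (suc i) v i<d = begin
      depth (iterate parent (parent v) i) ≡⟨ depth-iterate i (parent v) (s≤s⁻¹ (≤-trans i<d (≤-reflexive (sym pd)))) ⟩
      depth (parent v) ∸ i                ≡⟨ cong (_∸ suc i) pd ⟩
      depth v ∸ suc i                     ∎
    where
    open ≡-Reasoning
    pd : suc (depth (parent v)) ≡ depth v
    pd = parent-depth v (nonroot (≤-trans (s≤s z≤n) i<d))

  depth-ancestorAt : ∀ s u → s ≤ depth u → depth (ancestorAt s u) ≡ s
  depth-ancestorAt s u s≤d = trans (depth-iterate (depth u ∸ s) u (m∸n≤m (depth u) s)) (m∸[m∸n]≡n s≤d)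

  ancestorAt-self : ∀ {s} u → depth u ≡ s → ancestorAt s u ≡ u
  ancestorAt-self u refl = cong (iterate parent u) (n∸n≡0 (depth u))

  ancestorAt-parent : ∀ s a → a ≢ r → s ≤ depth (parent a) → ancestorAt s a ≡ ancestorAt s (parent a)
  ancestorAt-parent s a a≢r s≤dp = cong (iterate parent a) (begin
      depth a ∸ s                ≡⟨ cong (_∸ s) (sym (parent-depth a a≢r)) ⟩
      suc (depth (parent a)) ∸ s ≡⟨ +-∸-assoc 1 s≤dp ⟩
      suc (depth (parent a) ∸ s) ∎)
    where open ≡-Reasoning

  -- The ancestors of v at depths 0, …, depth v are distinct, so depth v < n.
  depth-bound : ∀ v → depth v < n
  depth-bound v = injective⇒≤ {f = λ (i : Fin (suc (depth v))) → ancestorAt (toℕ i) v} distinct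
    where
    below : ∀ (i : Fin (suc (depth v))) → toℕ i ≤ depth v
    below i = s≤s⁻¹ (toℕ<n i)
    distinct : ∀ {i j} → ancestorAt (toℕ i) v ≡ ancestorAt (toℕ j) v → i ≡ j
    distinct {i} {j} e = toℕ-injective
      (trans (sym (depth-ancestorAt (toℕ i) v (below i))) (trans (cong depth e) (depth-ancestorAt (toℕ j) v (below j))))

module PathRecognition (k : ℕ) (H : Graph (suc k)) (r : Fin (suc k))
    (reachable : ∀ v → ∃ λ t → walkWithin H ⊤ t r v ≡ true)
    (few-edges : Qcoeff H 2 1 ≤ k)
    (r-cut : components H (without r) ≤ 1)
    (cut : ∀ v → components H (without v) ≤ 2) where

  open BFS H r reachable

  IsTreeEdge : Fin (suc k) → Fin (suc k) → Set
  IsTreeEdge a b = a ≢ r × parent a ≡ b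

  treeEdge-injective : ∀ {u u′} → u ≢ r → u′ ≢ r → pair u (parent u) ≡ pair u′ (parent u′) → u ≡ u′
  treeEdge-injective {u} {u′} u≢r u′≢r e with pair-injective u (parent u) u′ (parent u′) (λ u≡pu → parent-≢ u u≢r (sym u≡pu)) e
  ... | inj₁ (u≡u′ , _) = u≡u′
  ... | inj₂ (u≡pu′ , pu≡u′) = ⊥-elim (<-asym
        (subst (λ w → depth w < depth u′) (sym u≡pu′) (parent-shallower u′ u′≢r))
        (subst (λ w → depth w < depth u) pu≡u′ (parent-shallower u u≢r)))

  -- An edge that is a tree edge in neither direction would give, with the
  -- k tree edges, k+1 connected two-vertex sets.
  no-extra-edge : ∀ {a b} → adj H a b ≡ true → ¬ IsTreeEdge a b → ¬ IsTreeEdge b a → ⊥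
  no-extra-edge {a} {b} ab ¬ab ¬ba = 1+n≰n (≤-trans too-many few-edges)
    where
    edgeSet : Fin (suc k) → Subset (suc k)
    edgeSet zero = pair a b
    edgeSet (suc i) = pair (punchIn r i) (parent (punchIn r i))

    is-edge : ∀ j → Qpred H 2 1 (edgeSet j) ≡ true
    is-edge zero = edge-Qpred H ab
    is-edge (suc i) = edge-Qpred H (trans (adj-sym H _ _) (parent-adj (punchIn r i) (punchInᵢ≢i r i)))

    extra-not-tree : ∀ i → pair a b ≢ pair (punchIn r i) (parent (punchIn r i))
    extra-not-tree i e with pair-injective a b (punchIn r i) (parent (punchIn r i)) (adjacent⇒distinct H ab) e
    ... | inj₁ (refl , refl) = ¬ab (punchInᵢ≢i r i , refl)
    ... | inj₂ (refl , refl) = ¬ba (punchInᵢ≢i r i , refl)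

    distinct : Injective _≡_ _≡_ edgeSet
    distinct {zero} {zero} _ = refl
    distinct {zero} {suc j} e = ⊥-elim (extra-not-tree j e)
    distinct {suc i} {zero} e = ⊥-elim (extra-not-tree i (sym e))
    distinct {suc i} {suc j} e =
      cong suc (punchIn-injective r i j (treeEdge-injective (punchInᵢ≢i r i) (punchInᵢ≢i r j) e))

    too-many : suc k ≤ Qcoeff H 2 1
    too-many = count-lower (≡-decVec _≟ᵇ_) (Qpred H 2 1) (allSubsets (suc k)) edgeSet distinct
                 (λ j → allSubsets-complete (edgeSet j)) is-edge

  every-edge-is-tree-edge : ∀ {a b} → adj H a b ≡ true → IsTreeEdge a b ⊎ IsTreeEdge b a
  every-edge-is-tree-edge {a} {b} ab with ¬? (a ≟ r) ×-dec (parent a ≟ b) | ¬? (b ≟ r) ×-dec (parent b ≟ a)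
  ... | yes ab-tree | _ = inj₁ ab-tree
  ... | no _ | yes ba-tree = inj₂ ba-tree
  ... | no ¬ab | no ¬ba = ⊥-elim (no-extra-edge ab ¬ab ¬ba)

  tree-edge-invariant : ∀ {A : Set} X (f : Fin (suc k) → A) →
    (∀ a → a ≢ r → inS X a ≡ true → inS X (parent a) ≡ true → f a ≡ f (parent a)) → EdgeInvariant H X f
  tree-edge-invariant X f along a b a∈X b∈X ab with every-edge-is-tree-edge ab
  ... | inj₁ (a≢r , refl) = along a a≢r a∈X b∈X
  ... | inj₂ (b≢r , refl) = sym (along b b≢r b∈X a∈X)

  -- If depth t holds a single vertex, depth t+1 cannot hold two vertices x ≠ y:
  -- both are children of the vertex v at depth t, and in H - v the branches
  -- below x and below y, and (if v ≠ r) the part above v, are separated.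
  module Siblings (t : ℕ) (depth-t-unique : ∀ {u u′} → depth u ≡ t → depth u′ ≡ t → u ≡ u′)
                  {x y : Fin (suc k)} (depth-x : depth x ≡ suc t) (depth-y : depth y ≡ suc t) (x≢y : x ≢ y) where

    child≢r : ∀ {c} → depth c ≡ suc t → c ≢ r
    child≢r dc = nonroot (≤-trans (s≤s z≤n) (≤-reflexive (sym dc)))

    v : Fin (suc k)
    v = parent x

    depth-v : depth v ≡ t
    depth-v = suc-injective (trans (parent-depth x (child≢r depth-x)) depth-x)

    child∈ : ∀ {c} → depth c ≡ suc t → inS (without v) c ≡ true
    child∈ {c} dc = without-other v c λ c≡v → 1+n≰n (≤-reflexive (trans (sym dc) (trans (cong depth c≡v) depth-v)))

    -- The vertex at depth t+1 above u, for u strictly below depth t.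
    branch : Fin (suc k) → Maybe (Fin (suc k))
    branch u = if t <ᵇ depth u then just (ancestorAt (suc t) u) else nothing

    branch-deep : ∀ u → t < depth u → branch u ≡ just (ancestorAt (suc t) u)
    branch-deep u t<d rewrite <ᵇ-complete t<d = refl

    branch-shallow : ∀ u → depth u ≤ t → branch u ≡ nothing
    branch-shallow u d≤t rewrite <ᵇ-false d≤t = refl

    branch-child : ∀ {c} → depth c ≡ suc t → branch c ≡ just c
    branch-child {c} dc = trans (branch-deep c (≤-reflexive (sym dc))) (cong just (ancestorAt-self c dc))

    -- Only a tree edge through v could change the branch.
    branch-parent : ∀ a → a ≢ r → inS (without v) (parent a) ≡ true → branch a ≡ branch (parent a)
    branch-parent a a≢r pa∈ with <-cmp (depth (parent a)) t
    ... | tri< dp<t _ _ = trans (branch-shallow a (subst (_≤ t) (parent-depth a a≢r) dp<t))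
                                (sym (branch-shallow (parent a) (<⇒≤ dp<t)))
    ... | tri≈ _ dp≡t _ = ⊥-elim (false≢true (trans (sym (without-self v))
                            (subst (λ w → inS (without v) w ≡ true) (depth-t-unique dp≡t depth-v) pa∈)))
    ... | tri> _ _ t<dp = trans (branch-deep a (<-trans t<dp (parent-shallower a a≢r)))
                          (trans (cong just (ancestorAt-parent (suc t) a a≢r t<dp)) (sym (branch-deep (parent a) t<dp)))

    side : Maybe (Fin (suc k)) → ℕ
    side (just c) = if c == x then 0 else if c == y then 1 else 2
    side nothing = 2

    label : Fin (suc k) → ℕ
    label u = side (branch u)

    label-invariant : EdgeInvariant H (without v) label
    label-invariant = tree-edge-invariant (without v) label (λ a a≢r _ pa∈ → cong side (branch-parent a a≢r pa∈))

    label-x : label x ≡ 0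
    label-x rewrite branch-child depth-x | ==-refl x = refl

    label-y : label y ≡ 1
    label-y rewrite branch-child depth-y | ==-false (λ y≡x → x≢y (sym y≡x)) | ==-refl y = refl

    two-branches : ∀ (j : Fin 2) → ∃ λ u → inS (without v) u ≡ true × label u ≡ toℕ j
    two-branches zero = x , child∈ depth-x , label-x
    two-branches (suc zero) = y , child∈ depth-y , label-y

    two-branches-and-above : v ≢ r → ∀ (j : Fin 3) → ∃ λ u → inS (without v) u ≡ true × label u ≡ toℕ j
    two-branches-and-above _ zero = two-branches zero
    two-branches-and-above _ (suc zero) = two-branches (suc zero)
    two-branches-and-above v≢r (suc (suc zero)) =
      parent v , without-other v (parent v) (parent-≢ v v≢r) ,
      cong side (branch-shallow (parent v) (≤-trans (n≤1+n _) (≤-reflexive (trans (parent-depth v v≢r) depth-v))))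

    impossible : ⊥
    impossible with v ≟ r
    ... | yes v≡r = 1+n≰n (≤-trans (components-≥ H (without v) label label-invariant two-branches)
                                   (subst (λ w → components H (without w) ≤ 1) (sym v≡r) r-cut))
    ... | no v≢r = 1+n≰n (≤-trans (components-≥ H (without v) label label-invariant (two-branches-and-above v≢r))
                                  (cut v))

  depth-unique : ∀ t {x y} → depth x ≡ t → depth y ≡ t → x ≡ y
  depth-unique zero dx dy = trans (depth-zero dx) (sym (depth-zero dy))
  depth-unique (suc t) {x} {y} dx dy with x ≟ y
  ... | yes x≡y = x≡y
  ... | no x≢y = ⊥-elim (Siblings.impossible t (depth-unique t) dx dy x≢y)

  depth-injective : ∀ {u v} → depth u ≡ depth v → u ≡ v
  depth-injective e = depth-unique _ e refl

  -- A vertex one level below u is u's child, hence adjacent to u.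
  child-adjacent : ∀ {u v} → depth v ≡ suc (depth u) → adj H u v ≡ true
  child-adjacent {u} {v} dv =
    subst (λ w → adj H w v ≡ true) (depth-injective (suc-injective (trans (parent-depth v v≢r) dv))) (parent-adj v v≢r)
    where
    v≢r : v ≢ r
    v≢r = nonroot (≤-trans (s≤s z≤n) (≤-reflexive (sym dv)))

  edge-depths : ∀ {u v} → adj H u v ≡ true → ((suc (depth u) ≡ᵇ depth v) ∨ (suc (depth v) ≡ᵇ depth u)) ≡ true
  edge-depths uv with every-edge-is-tree-edge uv
  ... | inj₁ (u≢r , refl) = ∨-introʳ _ (≡ᵇ-complete (parent-depth _ u≢r))
  ... | inj₂ (v≢r , refl) = ∨-introˡ _ (≡ᵇ-complete (parent-depth _ v≢r))

  adjacency : ∀ u v → adj H u v ≡ ((suc (depth u) ≡ᵇ depth v) ∨ (suc (depth v) ≡ᵇ depth u))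
  adjacency u v = bool-ext edge-depths depths⇒edge
    where
    depths⇒edge : ((suc (depth u) ≡ᵇ depth v) ∨ (suc (depth v) ≡ᵇ depth u)) ≡ true → adj H u v ≡ true
    depths⇒edge e with ∨-elim e
    ... | inj₁ dv = child-adjacent (sym (≡ᵇ-sound dv))
    ... | inj₂ du = trans (adj-sym H u v) (child-adjacent (sym (≡ᵇ-sound du)))

  position : Fin (suc k) → Fin (suc k)
  position v = fromℕ< (depth-bound v)

  iso : H ≅ P (suc k)
  iso = isomorphism-from-injection H (P (suc k)) position
    (λ e → depth-injective (trans (sym (toℕ-fromℕ< (depth-bound _))) (trans (cong toℕ e) (toℕ-fromℕ< (depth-bound _)))))
    (λ u v → trans (adjacency u v)
      (cong₂ (λ i j → (suc i ≡ᵇ j) ∨ (suc j ≡ᵇ i)) (sym (toℕ-fromℕ< (depth-bound u))) (sym (toℕ-fromℕ< (depth-bound v)))))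

Q-path-recognition : ∀ k (H : Graph (suc k)) → H ≡Q P (suc k) → H ≅ P (suc k)
Q-path-recognition k H q =
  let (r , r-cut) = H-leaf H q
  in PathRecognition.iso k H r (connected H (H-connected H q) r)
       (≤-trans (≤-reflexive (q 2 1)) (P-edge-count k)) r-cut (H-cut H q)

theorem4p3 : ∀ (n : ℕ) → n ≥ 1 → ∀ {m : ℕ} (H : Graph m) → H ≡Q P n → H ≅ P n
theorem4p3 zero () H q
theorem4p3 (suc k) _ H q = on-k+1-vertices (Q-vertices H (P (suc k)) q) H q
  where
  on-k+1-vertices : ∀ {m} → m ≡ suc k → (H : Graph m) → H ≡Q P (suc k) → H ≅ P (suc k)
  on-k+1-vertices refl = Q-path-recognition k
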